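{- For cycle graphs, $\mathrm{nim}(\mathrm{DNG}(C_{n}))=\begin{cases} 1, & \text{if }n\equiv_4 1,2 \\ 0, & \text{if }n\equiv_4 3,0. \end{cases} $
   Context: $C_n$ with $n\ge 3$ is the cycle graph on $n$ vertices. For a graph $G=(V,E)$, a set of vertices is geodetically convex if it contains every vertex on every shortest path between two of its vertices; the convex hull $[P]$ is the smallest convex set containing $P$, and $P$ is generating if $[P]=V$. In the avoidance game $\mathrm{DNG}(G)$, two players alternately select previously-unselected vertices such that the selected set never generates; the player who cannot move loses. $\mathrm{nim}$ denotes the nim-number of an impartial game; $\equiv_4$ denotes congruence modulo 4. -}

module Defs where

open import Data.Nat using (ℕ; zero; suc; _+_; _≤_; _<_)
open import Data.Nat.DivMod using (_%_)
open import Data.Fin using (Fin; toℕ)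
open import Data.Fin.Subset using (Subset; _∈_; _∉_; _⊆_; _∪_; ⁅_⁆; ⊥)
open import Data.Product using (Σ; ∃; _×_)
open import Data.Sum using (_⊎_)
open import Data.Empty using () renaming (⊥ to Empty)
open import Relation.Nullary using (¬_)
open import Relation.Binary.PropositionalEquality using (_≡_; _≢_)

Graph : ℕ → Set₁
Graph n = Fin n → Fin n → Set

Cycle : (n : ℕ) → Graph n
Cycle zero    ()
Cycle (suc m) i j = (suc (toℕ i) % suc m ≡ toℕ j) ⊎ (suc (toℕ j) % suc m ≡ toℕ i)

module _ {n : ℕ} (G : Graph n) where

  data Walk : Fin n → Fin n → ℕ → Set where
    stop : ∀ {x} → Walk x x 0
    step : ∀ {x y z k} → G x y → Walk y z k → Walk x z (suc k)

  data Visits (v : Fin n) : ∀ {x y k} → Walk x y k → Set where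
    here  : ∀ {y k} (w : Walk v y k) → Visits v w
    there : ∀ {x y z k} (e : G x y) {w : Walk y z k} → Visits v w → Visits v (step e w)

  Shortest : ∀ {x y k} → Walk x y k → Set
  Shortest {x} {y} {k} _ = ∀ {k'} → Walk x y k' → k ≤ k'

  OnShortestPath : Fin n → Fin n → Fin n → Set
  OnShortestPath x y z = Σ ℕ λ k → Σ (Walk x y k) λ w → Shortest w × Visits z w

  Convex : Subset n → Set
  Convex S = ∀ x y z → x ∈ S → y ∈ S → OnShortestPath x y z → z ∈ S

  -- P is generating iff its convex hull (the smallest convex set containing P,
  -- i.e. the intersection of all convex supersets of P) is all of V.
  Generating : Subset n → Set
  Generating P = ∀ S → P ⊆ S → Convex S → ∀ v → v ∈ S

  -- Positions of the avoidance game DNG(G) are the selected sets P (never generating).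
  -- A legal move from P selects an unselected vertex v with P ∪ {v} non-generating.
  Move : Subset n → Fin n → Set
  Move P v = v ∉ P × ¬ Generating (P ∪ ⁅ v ⁆)

  -- NimValue P g : the nim-number of the DNG(G) position P is g
  -- (g is the mex of the nim-numbers of the options of P).
  data NimValue (P : Subset n) (g : ℕ) : Set where
    mex : (∀ v → Move P v → Σ ℕ λ g' → NimValue (P ∪ ⁅ v ⁆) g' × g' ≢ g)
        → (∀ h → h < g → Σ (Fin n) λ v → Move P v × NimValue (P ∪ ⁅ v ⁆) h)
        → NimValue P g

NimDNG : ∀ {n} → Graph n → ℕ → Set
NimDNG G g = NimValue G ⊥ g

-- Write m = ⌈n/2⌉. A set of vertices of C_n is non-generating iff it lies in an arc of m
-- consecutive vertices. Such an arc is convex: as 2(m - 1) < n, a walk between two of its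
-- vertices that leaves it has to go round the rest of the cycle, which is longer than the
-- path inside the arc. Conversely, if a convex set S misses a vertex v, let p be the first
-- vertex of S after v; as n ≤ 2m, a vertex of S at least m steps past p would have v on a
-- shortest path back to p, so S lies in the arc of length m starting at p. Hence every
-- non-generating set extends to one of size exactly m, every play of DNG(C_n) lasts exactly
-- m moves, and the nim-number is m mod 2: 1 if n ≡ 1, 2 and 0 if n ≡ 3, 0 (mod 4).

module Submission where

open import Defs
open import Data.Nat using (ℕ; zero; suc; _+_; _*_; _∸_; _≤_; _<_; z≤n; s≤s; z<s; NonZero; ⌈_/2⌉)
open import Data.Nat.Properties
open import Data.Nat.DivMod
  using (_%_; _/_; _mod_; m≡m%n+[m/n]*n; m%n<n; m<n⇒m%n≡m; m%n%n≡m%n; %-distribˡ-+; [m+n]%n≡m%n)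
open import Data.Fin using (Fin; toℕ; fromℕ<)
open import Data.Fin.Properties using (any?; toℕ-injective; toℕ<n; toℕ-fromℕ<; toℕ-inject; ¬∀⟶∃¬-smallest)
open import Data.Fin.Subset using (Subset; _∈_; _∉_; _⊆_; _∪_; ⁅_⁆; ∣_∣; ⊥; inside; outside)
open import Data.Fin.Subset.Properties
  using (_∈?_; _⊆?_; nonempty?; ∪-identityʳ; p⊆q⇒∣p∣≤∣q∣; x∈p∪q⁻; x∈p∪q⁺; x∈⁅x⁆; x∈⁅y⁆⇒x≡y; ∉⊥; ∣⊥∣≡0)
open import Data.Vec using (_∷_; here; there)
open import Data.Product using (∃; ∃₂; _×_; _,_)
open import Data.Sum using (_⊎_; inj₁; inj₂; [_,_]′; swap)
open import Algebra.Properties.CommutativeSemigroup +-commutativeSemigroup using (interchange)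
open import Data.Empty using (⊥-elim) renaming (⊥ to Empty)
open import Relation.Nullary using (¬_; yes; no)
open import Relation.Nullary.Decidable using (decidable-stable; _×-dec_; ¬?)
open import Relation.Binary.PropositionalEquality
open import Function using (_∘′_)

%-separated : ∀ {m o} n .{{_ : NonZero n}} → m < o → m % n ≡ o % n → m + n ≤ o
%-separated {m} {o} n m<o m≡o = begin
  m + n                    ≡⟨ cong (_+ n) (m≡m%n+[m/n]*n m n) ⟩
  m % n + m / n * n + n    ≡⟨ +-assoc (m % n) (m / n * n) n ⟩
  m % n + (m / n * n + n)  ≡⟨ cong (m % n +_) (+-comm (m / n * n) n) ⟩
  m % n + suc (m / n) * n  ≤⟨ +-monoʳ-≤ (m % n) (*-monoˡ-≤ n m/n<o/n) ⟩
  m % n + o / n * n        ≡⟨ cong (_+ o / n * n) m≡o ⟩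
  o % n + o / n * n        ≡⟨ m≡m%n+[m/n]*n o n ⟨
  o                        ∎
  where
  open ≤-Reasoning
  o≡m%n+[o/n]*n : o ≡ m % n + o / n * n
  o≡m%n+[o/n]*n = trans (m≡m%n+[m/n]*n o n) (cong (_+ o / n * n) (sym m≡o))
  m/n<o/n : m / n < o / n
  m/n<o/n = *-cancelʳ-< n (m / n) (o / n)
              (+-cancelˡ-< (m % n) _ _ (subst₂ _<_ (m≡m%n+[m/n]*n m n) o≡m%n+[o/n]*n m<o))

[m%d+n]%d≡[m+n]%d : ∀ m n d .{{_ : NonZero d}} → (m % d + n) % d ≡ (m + n) % d
[m%d+n]%d≡[m+n]%d m n d = begin
  (m % d + n) % d          ≡⟨ %-distribˡ-+ (m % d) n d ⟩
  (m % d % d + n % d) % d  ≡⟨ cong (λ r → (r + n % d) % d) (m%n%n≡m%n m d) ⟩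
  (m % d + n % d) % d      ≡⟨ %-distribˡ-+ m n d ⟨
  (m + n) % d              ∎
  where open ≡-Reasoning

[m+n%d]%d≡[m+n]%d : ∀ m n d .{{_ : NonZero d}} → (m + n % d) % d ≡ (m + n) % d
[m+n%d]%d≡[m+n]%d m n d = begin
  (m + n % d) % d  ≡⟨ cong (_% d) (+-comm m (n % d)) ⟩
  (n % d + m) % d  ≡⟨ [m%d+n]%d≡[m+n]%d n m d ⟩
  (n + m) % d      ≡⟨ cong (_% d) (+-comm n m) ⟩
  (m + n) % d      ∎
  where open ≡-Reasoning

n%2≢[1+n]%2 : ∀ n → n % 2 ≢ suc n % 2
n%2≢[1+n]%2 0 ()
n%2≢[1+n]%2 1 ()
n%2≢[1+n]%2 (suc (suc n)) = n%2≢[1+n]%2 n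

m<[1+n]%2⇒m≡n%2 : ∀ {m} n → m < suc n % 2 → m ≡ n % 2
m<[1+n]%2⇒m≡n%2 {zero} 0 _ = refl
m<[1+n]%2⇒m≡n%2 {suc _} 0 (s≤s ())
m<[1+n]%2⇒m≡n%2 1 ()
m<[1+n]%2⇒m≡n%2 (suc (suc n)) m<n = m<[1+n]%2⇒m≡n%2 n m<n

∣p∪⁅x⁆∣≡1+∣p∣ : ∀ {n} {p : Subset n} {x} → x ∉ p → ∣ p ∪ ⁅ x ⁆ ∣ ≡ suc ∣ p ∣
∣p∪⁅x⁆∣≡1+∣p∣ {p = inside ∷ p}  {Fin.zero}  x∉p = ⊥-elim (x∉p here)
∣p∪⁅x⁆∣≡1+∣p∣ {p = outside ∷ p} {Fin.zero}  _   = cong (suc ∘′ ∣_∣) (∪-identityʳ p)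
∣p∪⁅x⁆∣≡1+∣p∣ {p = inside ∷ p}  {Fin.suc x} x∉p = cong suc (∣p∪⁅x⁆∣≡1+∣p∣ (x∉p ∘′ there))
∣p∪⁅x⁆∣≡1+∣p∣ {p = outside ∷ p} {Fin.suc x} x∉p = ∣p∪⁅x⁆∣≡1+∣p∣ (x∉p ∘′ there)

∣p∣<∣q∣⇒∃∈q∉p : ∀ {n} {p q : Subset n} → ∣ p ∣ < ∣ q ∣ → ∃ λ x → x ∈ q × x ∉ p
∣p∣<∣q∣⇒∃∈q∉p {p = p} {q} ∣p∣<∣q∣ with any? (λ x → x ∈? q ×-dec ¬? (x ∈? p))
... | yes found = found
... | no none   = ⊥-elim (<⇒≱ ∣p∣<∣q∣ (p⊆q⇒∣p∣≤∣q∣ q⊆p))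
  where
  q⊆p : ∀ {x} → x ∈ q → x ∈ p
  q⊆p {x} x∈q = decidable-stable (x ∈? p) (λ x∉p → none (x , x∈q , x∉p))

module _ {n} {G : Graph n} where

  split-at-visit : ∀ {x y z k} {w : Walk G x y k} → Visits G z w →
                   ∃₂ λ k₁ k₂ → Walk G x z k₁ × Walk G z y k₂ × k₁ + k₂ ≡ k
  split-at-visit (here w) = 0 , _ , stop , w , refl
  split-at-visit (there e z∈w) with split-at-visit z∈w
  ... | k₁ , k₂ , w₁ , w₂ , refl = suc k₁ , k₂ , step e w₁ , w₂ , refl

  module _ (G-sym : ∀ {x y} → G x y → G y x) where

    reverse-onto : ∀ {x y z k j} → Walk G x y k → Walk G x z j → Walk G y z (k + j)
    reverse-onto stop acc = acc
    reverse-onto {k = suc k} {j} (step e w) acc =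
      subst (Walk G _ _) (+-suc k j) (reverse-onto w (step (G-sym e) acc))

    reverse : ∀ {x y k} → Walk G x y k → Walk G y x k
    reverse w = subst (Walk G _ _) (+-identityʳ _) (reverse-onto w stop)

module _ {n} (G : Graph n) (m : ℕ)
         (nongenerating-small : ∀ {P} → ¬ Generating G P → ∣ P ∣ ≤ m)
         (nongenerating-extends : ∀ {P} → ¬ Generating G P → ∣ P ∣ < m → ∃ (Move G P))
         where

  nimValue-parity : ∀ j {P} → ¬ Generating G P → ∣ P ∣ + j ≡ m → NimValue G P (j % 2)
  nimValue-parity zero {P} _ ∣P∣+0≡m = mex no-move (λ _ ())
    where
    no-move : ∀ v → Move G P v → ∃ λ g → NimValue G (P ∪ ⁅ v ⁆) g × g ≢ 0
    no-move v (v∉P , ¬gen) = ⊥-elim (1+n≰n (begin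
      suc ∣ P ∣      ≡⟨ ∣p∪⁅x⁆∣≡1+∣p∣ v∉P ⟨
      ∣ P ∪ ⁅ v ⁆ ∣  ≤⟨ nongenerating-small ¬gen ⟩
      m              ≡⟨ ∣P∣+0≡m ⟨
      ∣ P ∣ + 0      ≡⟨ +-identityʳ ∣ P ∣ ⟩
      ∣ P ∣          ∎))
      where open ≤-Reasoning
  nimValue-parity (suc j) {P} ¬gen ∣P∣+1+j≡m =
    mex (λ v move → j % 2 , after move , n%2≢[1+n]%2 j)
        (λ h h<[1+j]%2 → let v , move = nongenerating-extends ¬gen ∣P∣<m in
          v , move , subst (NimValue G (P ∪ ⁅ v ⁆)) (sym (m<[1+n]%2⇒m≡n%2 j h<[1+j]%2)) (after move))
    where
    ∣P∣<m : ∣ P ∣ < m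
    ∣P∣<m = subst (∣ P ∣ <_) ∣P∣+1+j≡m (m<m+n ∣ P ∣ z<s)
    after : ∀ {v} → Move G P v → NimValue G (P ∪ ⁅ v ⁆) (j % 2)
    after (v∉P , ¬gen') = nimValue-parity j ¬gen'
      (trans (cong (_+ j) (∣p∪⁅x⁆∣≡1+∣p∣ v∉P)) (trans (sym (+-suc ∣ P ∣ j)) ∣P∣+1+j≡m))

  nimDNG-parity : ¬ Generating G ⊥ → NimDNG G (m % 2)
  nimDNG-parity ¬gen = nimValue-parity m ¬gen (cong (_+ m) (∣⊥∣≡0 n))

-- L₁ and L₂ are the forward offsets of the two legs of a detour, and the last two hypotheses
-- say that each leg either goes forward or round the other side of the cycle.
detour-bound : ∀ {n i t D k₁ k₂ L₁ L₂} → i + L₁ ≡ t → L₁ + L₂ ≡ n + D →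
               i + D < t → t < n → D + D < n →
               L₁ ≤ k₁ ⊎ n ≤ L₁ + k₁ → L₂ ≤ k₂ ⊎ n ≤ L₂ + k₂ → D < k₁ + k₂
detour-bound {n} {i} {t} {D} {k₁} {k₂} {L₁} {L₂} i+L₁≡t L₁+L₂≡n+D i+D<t t<n 2D<n b₁ b₂ =
  ≰⇒> (λ k≤D → impossible k≤D b₁ b₂)
  where
  open ≤-Reasoning
  L₁<n : L₁ < n
  L₁<n = ≤-<-trans (subst (L₁ ≤_) i+L₁≡t (m≤n+m L₁ i)) t<n
  impossible : k₁ + k₂ ≤ D → L₁ ≤ k₁ ⊎ n ≤ L₁ + k₁ → L₂ ≤ k₂ ⊎ n ≤ L₂ + k₂ → Empty
  impossible k≤D (inj₁ L₁≤k₁) _ = <⇒≱ i+D<t (begin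
    t       ≡⟨ i+L₁≡t ⟨
    i + L₁  ≤⟨ +-monoʳ-≤ i (≤-trans L₁≤k₁ (≤-trans (m≤m+n k₁ k₂) k≤D)) ⟩
    i + D   ∎)
  impossible k≤D (inj₂ n≤L₁+k₁) (inj₁ L₂≤k₂) = <⇒≱ (+-mono-< L₁<n L₁<n) (+-cancelʳ-≤ D (n + n) (L₁ + L₁) (begin
    n + n + D              ≡⟨ +-assoc n n D ⟩
    n + (n + D)            ≡⟨ cong (n +_) L₁+L₂≡n+D ⟨
    n + (L₁ + L₂)          ≤⟨ +-mono-≤ n≤L₁+k₁ (+-monoʳ-≤ L₁ L₂≤k₂) ⟩
    L₁ + k₁ + (L₁ + k₂)    ≡⟨ interchange L₁ k₁ L₁ k₂ ⟩
    L₁ + L₁ + (k₁ + k₂)    ≤⟨ +-monoʳ-≤ (L₁ + L₁) k≤D ⟩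
    L₁ + L₁ + D            ∎))
  impossible k≤D (inj₂ n≤L₁+k₁) (inj₂ n≤L₂+k₂) = <⇒≱ 2D<n (+-cancelˡ-≤ n n (D + D) (begin
    n + n                  ≤⟨ +-mono-≤ n≤L₁+k₁ n≤L₂+k₂ ⟩
    L₁ + k₁ + (L₂ + k₂)    ≡⟨ interchange L₁ k₁ L₂ k₂ ⟩
    L₁ + L₂ + (k₁ + k₂)    ≤⟨ +-mono-≤ (≤-reflexive L₁+L₂≡n+D) k≤D ⟩
    n + D + D              ≡⟨ +-assoc n D D ⟩
    n + (D + D)            ∎))

module CycleGeometry (N : ℕ) where

  n : ℕ
  n = suc N

  C : Graph n
  C = Cycle n

  infixl 6 _⊕_
  _⊕_ : Fin n → ℕ → Fin n
  x ⊕ i = (toℕ x + i) mod n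

  toℕ-⊕ : ∀ x i → toℕ (x ⊕ i) ≡ (toℕ x + i) % n
  toℕ-⊕ x i = toℕ-fromℕ< (m%n<n (toℕ x + i) n)

  ⊕-identityʳ : ∀ x → x ⊕ 0 ≡ x
  ⊕-identityʳ x = toℕ-injective (begin
    toℕ (x ⊕ 0)      ≡⟨ toℕ-⊕ x 0 ⟩
    (toℕ x + 0) % n  ≡⟨ cong (_% n) (+-identityʳ (toℕ x)) ⟩
    toℕ x % n        ≡⟨ m<n⇒m%n≡m (toℕ<n x) ⟩
    toℕ x            ∎)
    where open ≡-Reasoning

  ⊕-assoc : ∀ x i j → x ⊕ i ⊕ j ≡ x ⊕ (i + j)
  ⊕-assoc x i j = toℕ-injective (begin
    toℕ (x ⊕ i ⊕ j)            ≡⟨ toℕ-⊕ (x ⊕ i) j ⟩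
    (toℕ (x ⊕ i) + j) % n      ≡⟨ cong (λ r → (r + j) % n) (toℕ-⊕ x i) ⟩
    ((toℕ x + i) % n + j) % n  ≡⟨ [m%d+n]%d≡[m+n]%d (toℕ x + i) j n ⟩
    (toℕ x + i + j) % n        ≡⟨ cong (_% n) (+-assoc (toℕ x) i j) ⟩
    (toℕ x + (i + j)) % n      ≡⟨ toℕ-⊕ x (i + j) ⟨
    toℕ (x ⊕ (i + j))          ∎)
    where open ≡-Reasoning

  ⊕-suc : ∀ x i → x ⊕ i ⊕ 1 ≡ x ⊕ suc i
  ⊕-suc x i = trans (⊕-assoc x i 1) (cong (x ⊕_) (+-comm i 1))

  ⊕-period : ∀ x i → x ⊕ (i + n) ≡ x ⊕ i
  ⊕-period x i = toℕ-injective (begin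
    toℕ (x ⊕ (i + n))      ≡⟨ toℕ-⊕ x (i + n) ⟩
    (toℕ x + (i + n)) % n  ≡⟨ cong (_% n) (+-assoc (toℕ x) i n) ⟨
    (toℕ x + i + n) % n    ≡⟨ [m+n]%n≡m%n (toℕ x + i) n ⟩
    (toℕ x + i) % n        ≡⟨ toℕ-⊕ x i ⟨
    toℕ (x ⊕ i)            ∎)
    where open ≡-Reasoning

  ⊕-separated : ∀ x {i j} → i < j → x ⊕ i ≡ x ⊕ j → i + n ≤ j
  ⊕-separated x {i} {j} i<j x⊕i≡x⊕j = +-cancelˡ-≤ (toℕ x) (i + n) j
    (subst (_≤ toℕ x + j) (+-assoc (toℕ x) i n)
      (%-separated n (+-monoʳ-< (toℕ x) i<j)
        (trans (sym (toℕ-⊕ x i)) (trans (cong toℕ x⊕i≡x⊕j) (toℕ-⊕ x j)))))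

  offset : ∀ a u → ∃ λ i → i < n × a ⊕ i ≡ u
  offset a u = i , m%n<n (toℕ u + (n ∸ toℕ a)) n , toℕ-injective (begin
    toℕ (a ⊕ i)                                ≡⟨ toℕ-⊕ a i ⟩
    (toℕ a + (toℕ u + (n ∸ toℕ a)) % n) % n    ≡⟨ [m+n%d]%d≡[m+n]%d (toℕ a) _ n ⟩
    (toℕ a + (toℕ u + (n ∸ toℕ a))) % n        ≡⟨ cong (_% n) (+-comm (toℕ a) _) ⟩
    (toℕ u + (n ∸ toℕ a) + toℕ a) % n          ≡⟨ cong (_% n) (+-assoc (toℕ u) _ _) ⟩
    (toℕ u + (n ∸ toℕ a + toℕ a)) % n          ≡⟨ cong (λ r → (toℕ u + r) % n) (m∸n+n≡m (<⇒≤ (toℕ<n a))) ⟩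
    (toℕ u + n) % n                            ≡⟨ [m+n]%n≡m%n (toℕ u) n ⟩
    toℕ u % n                                  ≡⟨ m<n⇒m%n≡m (toℕ<n u) ⟩
    toℕ u                                      ∎)
    where
    open ≡-Reasoning
    i = (toℕ u + (n ∸ toℕ a)) % n

  toℕ-⊕1 : ∀ x → toℕ (x ⊕ 1) ≡ suc (toℕ x) % n
  toℕ-⊕1 x = trans (toℕ-⊕ x 1) (cong (_% n) (+-comm (toℕ x) 1))

  ⊕1-adjacent : ∀ x → C x (x ⊕ 1)
  ⊕1-adjacent x = inj₁ (sym (toℕ-⊕1 x))

  adjacent⇒⊕1 : ∀ {x y} → C x y → x ⊕ 1 ≡ y ⊎ y ⊕ 1 ≡ x
  adjacent⇒⊕1 {x} (inj₁ e) = inj₁ (toℕ-injective (trans (toℕ-⊕1 x) e))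
  adjacent⇒⊕1 {y = y} (inj₂ e) = inj₂ (toℕ-injective (trans (toℕ-⊕1 y) e))

  reverse-walk : ∀ {x y k} → Walk C x y k → Walk C y x k
  reverse-walk = reverse swap

  -- a counts the forward steps of the walk and b the backward ones.
  walk-displacement : ∀ {x y k} → Walk C x y k → ∃₂ λ a b → a + b ≡ k × x ⊕ a ≡ y ⊕ b
  walk-displacement stop = 0 , 0 , refl , refl
  walk-displacement {x} {y} (step {y = x'} e w) with walk-displacement w | adjacent⇒⊕1 e
  ... | a , b , refl , x'⊕a≡y⊕b | inj₁ x⊕1≡x' = suc a , b , refl , (begin
    x ⊕ suc a    ≡⟨ ⊕-assoc x 1 a ⟨
    x ⊕ 1 ⊕ a    ≡⟨ cong (_⊕ a) x⊕1≡x' ⟩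
    x' ⊕ a       ≡⟨ x'⊕a≡y⊕b ⟩
    y ⊕ b        ∎)
    where open ≡-Reasoning
  ... | a , b , refl , x'⊕a≡y⊕b | inj₂ x'⊕1≡x = a , suc b , +-suc a b , (begin
    x ⊕ a        ≡⟨ cong (_⊕ a) x'⊕1≡x ⟨
    x' ⊕ 1 ⊕ a   ≡⟨ ⊕-assoc x' 1 a ⟩
    x' ⊕ suc a   ≡⟨ ⊕-suc x' a ⟨
    x' ⊕ a ⊕ 1   ≡⟨ cong (_⊕ 1) x'⊕a≡y⊕b ⟩
    y ⊕ b ⊕ 1    ≡⟨ ⊕-suc y b ⟩
    y ⊕ suc b    ∎)
    where open ≡-Reasoning

  walk-length-bound : ∀ {x y k} L → Walk C x y k → x ⊕ L ≡ y → L ≤ k ⊎ n ≤ L + k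
  walk-length-bound {x} L w x⊕L≡y with walk-displacement w
  ... | a , b , refl , x⊕a≡y⊕b with L + b ≤? a
  ...   | yes L+b≤a = inj₁ (≤-trans (m≤m+n L b) (≤-trans L+b≤a (m≤m+n a b)))
  ...   | no  L+b≰a = inj₂ (begin
    n            ≤⟨ m≤n+m n a ⟩
    a + n        ≤⟨ ⊕-separated x (≰⇒> L+b≰a) x⊕a≡x⊕[L+b] ⟩
    L + b        ≤⟨ +-monoʳ-≤ L (m≤n+m b a) ⟩
    L + (a + b)  ∎)
    where
    open ≤-Reasoning
    x⊕a≡x⊕[L+b] : x ⊕ a ≡ x ⊕ (L + b)
    x⊕a≡x⊕[L+b] = trans x⊕a≡y⊕b (trans (cong (_⊕ b) (sym x⊕L≡y)) (⊕-assoc x L b))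

  forward : ∀ x L {y} → x ⊕ L ≡ y → Walk C x y L
  forward x zero    x⊕0≡y = subst (λ y → Walk C x y 0) (trans (sym (⊕-identityʳ x)) x⊕0≡y) stop
  forward x (suc L) x⊕L≡y = step (⊕1-adjacent x) (forward (x ⊕ 1) L (trans (⊕-assoc x 1 L) x⊕L≡y))

  forward-visits : ∀ x L {y} (x⊕L≡y : x ⊕ L ≡ y) {i} → i ≤ L → Visits C (x ⊕ i) (forward x L x⊕L≡y)
  forward-visits x L x⊕L≡y {zero} _ =
    subst (λ v → Visits C v (forward x L x⊕L≡y)) (sym (⊕-identityʳ x)) (here _)
  forward-visits x (suc L) x⊕L≡y {suc i} (s≤s i≤L) =
    there (⊕1-adjacent x) (subst (λ v → Visits C v _) (⊕-assoc x 1 i) (forward-visits (x ⊕ 1) L _ i≤L))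

  forward-shortest : ∀ x L {y} (x⊕L≡y : x ⊕ L ≡ y) → L + L ≤ n → Shortest C (forward x L x⊕L≡y)
  forward-shortest x L x⊕L≡y 2L≤n w with walk-length-bound L w x⊕L≡y
  ... | inj₁ L≤k   = L≤k
  ... | inj₂ n≤L+k = +-cancelˡ-≤ L L _ (≤-trans 2L≤n n≤L+k)

  arc : Fin n → ℕ → Subset n
  arc a zero    = ⊥
  arc a (suc j) = arc a j ∪ ⁅ a ⊕ j ⁆

  ∈-arc⁻ : ∀ a j {u} → u ∈ arc a j → ∃ λ i → i < j × a ⊕ i ≡ u
  ∈-arc⁻ a zero    u∈arc = ⊥-elim (∉⊥ u∈arc)
  ∈-arc⁻ a (suc j) u∈arc with x∈p∪q⁻ (arc a j) ⁅ a ⊕ j ⁆ u∈arc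
  ... | inj₁ u∈arc' = let i , i<j , a⊕i≡u = ∈-arc⁻ a j u∈arc' in i , m<n⇒m<1+n i<j , a⊕i≡u
  ... | inj₂ u∈⁅a⊕j⁆ = j , ≤-refl , sym (x∈⁅y⁆⇒x≡y (a ⊕ j) u∈⁅a⊕j⁆)

  ∈-arc⁺ : ∀ a {i j} → i < j → a ⊕ i ∈ arc a j
  ∈-arc⁺ a {i} {suc j} i<1+j with m<1+n⇒m<n∨m≡n i<1+j
  ... | inj₁ i<j  = x∈p∪q⁺ (inj₁ (∈-arc⁺ a i<j))
  ... | inj₂ refl = x∈p∪q⁺ (inj₂ (x∈⁅x⁆ (a ⊕ i)))

  ⊕∉arc : ∀ a {j} → j < n → a ⊕ j ∉ arc a j
  ⊕∉arc a j<n a⊕j∈arc with ∈-arc⁻ a _ a⊕j∈arc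
  ... | i , i<j , a⊕i≡a⊕j = <⇒≱ j<n (≤-trans (m≤n+m n i) (⊕-separated a i<j a⊕i≡a⊕j))

  ∣arc∣ : ∀ a {j} → j ≤ n → ∣ arc a j ∣ ≡ j
  ∣arc∣ a {zero}  _   = ∣⊥∣≡0 n
  ∣arc∣ a {suc j} j<n = trans (∣p∪⁅x⁆∣≡1+∣p∣ (⊕∉arc a j<n)) (cong suc (∣arc∣ a (<⇒≤ j<n)))

  detour-outside-arc : ∀ {m} a {i j D t k₁ k₂} → m + m ≤ suc n → i + D ≡ j → j < m → m ≤ t → t < n →
                       Walk C (a ⊕ i) (a ⊕ t) k₁ → Walk C (a ⊕ t) (a ⊕ j) k₂ → D < k₁ + k₂
  detour-outside-arc {m} a {i} {j} {D} {t} 2m≤1+n i+D≡j j<m m≤t t<n w₁ w₂ with m≤n⇒∃[o]m+o≡n i≤t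
    where i≤t = ≤-trans (m≤m+n i D) (≤-trans (≤-reflexive i+D≡j) (<⇒≤ (<-≤-trans j<m m≤t)))
  ... | L₁ , i+L₁≡t = detour-bound i+L₁≡t L₁+L₂≡n+D (subst (_< t) (sym i+D≡j) (<-≤-trans j<m m≤t)) t<n 2D<n
                        (walk-length-bound L₁ w₁ (trans (⊕-assoc a i L₁) (cong (a ⊕_) i+L₁≡t)))
                        (walk-length-bound L₂ w₂ a⊕t⊕L₂≡a⊕j)
    where
    L₂ = n ∸ L₁ + D
    L₁+L₂≡n+D : L₁ + L₂ ≡ n + D
    L₁+L₂≡n+D = trans (sym (+-assoc L₁ (n ∸ L₁) D))
                  (cong (_+ D) (m+[n∸m]≡n (≤-trans (m≤n+m L₁ i) (≤-trans (≤-reflexive i+L₁≡t) (<⇒≤ t<n)))))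
    D<m : D < m
    D<m = ≤-<-trans (≤-trans (m≤n+m D i) (≤-reflexive i+D≡j)) j<m
    2D<n : D + D < n
    2D<n = ≤-pred (begin
      suc (suc (D + D))  ≡⟨ cong suc (+-suc D D) ⟨
      suc D + suc D      ≤⟨ +-mono-≤ D<m D<m ⟩
      m + m              ≤⟨ 2m≤1+n ⟩
      suc n              ∎)
      where open ≤-Reasoning
    a⊕t⊕L₂≡a⊕j : a ⊕ t ⊕ L₂ ≡ a ⊕ j
    a⊕t⊕L₂≡a⊕j = begin
      a ⊕ t ⊕ L₂           ≡⟨ ⊕-assoc a t L₂ ⟩
      a ⊕ (t + L₂)         ≡⟨ cong (λ s → a ⊕ (s + L₂)) i+L₁≡t ⟨
      a ⊕ (i + L₁ + L₂)    ≡⟨ cong (a ⊕_) (+-assoc i L₁ L₂) ⟩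
      a ⊕ (i + (L₁ + L₂))  ≡⟨ cong (λ s → a ⊕ (i + s)) (trans L₁+L₂≡n+D (+-comm n D)) ⟩
      a ⊕ (i + (D + n))    ≡⟨ cong (a ⊕_) (+-assoc i D n) ⟨
      a ⊕ (i + D + n)      ≡⟨ ⊕-period a (i + D) ⟩
      a ⊕ (i + D)          ≡⟨ cong (a ⊕_) i+D≡j ⟩
      a ⊕ j                ∎
      where open ≡-Reasoning

  shortcut-within-arc : ∀ {m} a {i j t k₁ k₂} → m + m ≤ suc n → i < m → j < m → m ≤ t → t < n →
                        Walk C (a ⊕ i) (a ⊕ t) k₁ → Walk C (a ⊕ t) (a ⊕ j) k₂ →
                        ∃ λ D → D < k₁ + k₂ × Walk C (a ⊕ i) (a ⊕ j) D
  shortcut-within-arc a {i} {j} {k₁ = k₁} {k₂} 2m≤1+n i<m j<m m≤t t<n w₁ w₂ with ≤-total i j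
  ... | inj₁ i≤j = let D , i+D≡j = m≤n⇒∃[o]m+o≡n i≤j in
    D , detour-outside-arc a 2m≤1+n i+D≡j j<m m≤t t<n w₁ w₂ ,
    forward (a ⊕ i) D (trans (⊕-assoc a i D) (cong (a ⊕_) i+D≡j))
  ... | inj₂ j≤i = let D , j+D≡i = m≤n⇒∃[o]m+o≡n j≤i in
    D , subst (D <_) (+-comm k₂ k₁)
          (detour-outside-arc a 2m≤1+n j+D≡i i<m m≤t t<n (reverse-walk w₂) (reverse-walk w₁)) ,
    reverse-walk (forward (a ⊕ j) D (trans (⊕-assoc a j D) (cong (a ⊕_) j+D≡i)))

  arc-convex : ∀ a m → m + m ≤ suc n → Convex C (arc a m)
  arc-convex a m 2m≤1+n x y z x∈arc y∈arc (k , w , w-shortest , z∈w)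
    with ∈-arc⁻ a m x∈arc | ∈-arc⁻ a m y∈arc | offset a z
  ... | i , i<m , refl | j , j<m , refl | t , t<n , refl with t <? m
  ...   | yes t<m = ∈-arc⁺ a t<m
  ...   | no  t≮m with split-at-visit z∈w
  ...     | k₁ , k₂ , w₁ , w₂ , refl =
    let D , D<k , w′ = shortcut-within-arc a 2m≤1+n i<m j<m (≮⇒≥ t≮m) t<n w₁ w₂
    in ⊥-elim (<⇒≱ D<k (w-shortest w′))

  wraparound-geodesic : ∀ v {t s} → t + s < n → n ≤ s + s → OnShortestPath C (v ⊕ (t + s)) (v ⊕ t) v
  wraparound-geodesic v {t} {s} t+s<n n≤2s =
    L , forward u L u⊕L≡v⊕t , forward-shortest u L u⊕L≡v⊕t 2L≤n ,
    subst (λ x → Visits C x (forward u L u⊕L≡v⊕t)) u⊕i≡v (forward-visits u L u⊕L≡v⊕t i≤L)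
    where
    open ≡-Reasoning
    u = v ⊕ (t + s)
    L = n ∸ s
    i = n ∸ (t + s)
    s+L≡n : s + L ≡ n
    s+L≡n = m+[n∸m]≡n (≤-trans (m≤n+m s t) (<⇒≤ t+s<n))
    u⊕L≡v⊕t : u ⊕ L ≡ v ⊕ t
    u⊕L≡v⊕t = begin
      v ⊕ (t + s) ⊕ L    ≡⟨ ⊕-assoc v (t + s) L ⟩
      v ⊕ (t + s + L)    ≡⟨ cong (v ⊕_) (+-assoc t s L) ⟩
      v ⊕ (t + (s + L))  ≡⟨ cong (λ r → v ⊕ (t + r)) s+L≡n ⟩
      v ⊕ (t + n)        ≡⟨ ⊕-period v t ⟩
      v ⊕ t              ∎
    u⊕i≡v : u ⊕ i ≡ v
    u⊕i≡v = begin
      v ⊕ (t + s) ⊕ i    ≡⟨ ⊕-assoc v (t + s) i ⟩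
      v ⊕ (t + s + i)    ≡⟨ cong (v ⊕_) (m+[n∸m]≡n (<⇒≤ t+s<n)) ⟩
      v ⊕ (0 + n)        ≡⟨ ⊕-period v 0 ⟩
      v ⊕ 0              ≡⟨ ⊕-identityʳ v ⟩
      v                  ∎
    i≤L : i ≤ L
    i≤L = ∸-monoʳ-≤ n (m≤n+m s t)
    L≤s : L ≤ s
    L≤s = ≤-trans (∸-monoˡ-≤ s n≤2s) (≤-reflexive (m+n∸n≡m s s))
    2L≤n : L + L ≤ n
    2L≤n = ≤-trans (+-monoˡ-≤ L L≤s) (≤-reflexive s+L≡n)

  first-forward : ∀ {S : Subset n} v {u} → u ∈ S →
                  ∃ λ t → t < n × v ⊕ t ∈ S × (∀ {s} → s < t → v ⊕ s ∉ S)
  first-forward {S} v {u} u∈S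
    with ¬∀⟶∃¬-smallest n (λ i → v ⊕ toℕ i ∉ S) (λ i → ¬? (v ⊕ toℕ i ∈? S)) S-met
    where
    S-met : ¬ (∀ i → v ⊕ toℕ i ∉ S)
    S-met all∉ = let r , r<n , v⊕r≡u = offset v u in
      all∉ (fromℕ< r<n) (subst (_∈ S) (sym (trans (cong (v ⊕_) (toℕ-fromℕ< r<n)) v⊕r≡u)) u∈S)
  ... | i , ¬v⊕i∉S , earlier = toℕ i , toℕ<n i , decidable-stable (v ⊕ toℕ i ∈? S) ¬v⊕i∉S , before
    where
    before : ∀ {s} → s < toℕ i → v ⊕ s ∉ S
    before s<i = subst (λ r → v ⊕ r ∉ S) (trans (toℕ-inject (fromℕ< s<i)) (toℕ-fromℕ< s<i))
                   (earlier (fromℕ< s<i))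

  -- S lies in the arc of length m starting at the first vertex v ⊕ t of S after v.
  convex-avoiding⇒⊆arc : ∀ m {S v} → n ≤ m + m → Convex C S → v ∉ S → ∃ λ p → S ⊆ arc p m
  convex-avoiding⇒⊆arc m {S} {v} n≤2m S-convex v∉S with nonempty? S
  ... | no S-empty = v , λ {u} u∈S → ⊥-elim (S-empty (u , u∈S))
  ... | yes (_ , u₀∈S) with first-forward v u₀∈S
  ...   | t , t<n , v⊕t∈S , before-t∉S = v ⊕ t , within
    where
    within : ∀ {u} → u ∈ S → u ∈ arc (v ⊕ t) m
    within {u} u∈S with offset v u
    ... | r , r<n , refl with t ≤? r
    ...   | no  t≰r = ⊥-elim (before-t∉S (≰⇒> t≰r) u∈S)
    ...   | yes t≤r with m≤n⇒∃[o]m+o≡n t≤r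
    ...     | s , refl with s <? m
    ...       | yes s<m = subst (_∈ arc (v ⊕ t) m) (⊕-assoc v t s) (∈-arc⁺ (v ⊕ t) s<m)
    ...       | no  s≮m = ⊥-elim (v∉S (S-convex _ _ v u∈S v⊕t∈S
                  (wraparound-geodesic v r<n (≤-trans n≤2m (+-mono-≤ (≮⇒≥ s≮m) (≮⇒≥ s≮m))))))

  ⊆arc⇒¬generating : ∀ a m {P} → m + m ≤ suc n → m < n → P ⊆ arc a m → ¬ Generating C P
  ⊆arc⇒¬generating a m 2m≤1+n m<n P⊆arc generating =
    ⊕∉arc a m<n (generating (arc a m) P⊆arc (arc-convex a m 2m≤1+n) (a ⊕ m))

  ¬generating⇒⊆arc : ∀ m {P} → n ≤ m + m → ¬ Generating C P → ∃ λ a → P ⊆ arc a m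
  ¬generating⇒⊆arc m {P} n≤2m ¬generating with any? (λ a → P ⊆? arc a m)
  ... | yes P⊆arc = P⊆arc
  ... | no  P⊈arc = ⊥-elim (¬generating λ S P⊆S S-convex v → decidable-stable (v ∈? S) λ v∉S →
          let p , S⊆arc = convex-avoiding⇒⊆arc m n≤2m S-convex v∉S in P⊈arc (p , S⊆arc ∘′ P⊆S))

⌈n/2⌉+⌈n/2⌉≤1+n : ∀ n → ⌈ n /2⌉ + ⌈ n /2⌉ ≤ suc n
⌈n/2⌉+⌈n/2⌉≤1+n zero = z≤n
⌈n/2⌉+⌈n/2⌉≤1+n (suc zero) = ≤-refl
⌈n/2⌉+⌈n/2⌉≤1+n (suc (suc n)) =
  s≤s (subst (_≤ suc (suc n)) (sym (+-suc ⌈ n /2⌉ ⌈ n /2⌉)) (s≤s (⌈n/2⌉+⌈n/2⌉≤1+n n)))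

n≤⌈n/2⌉+⌈n/2⌉ : ∀ n → n ≤ ⌈ n /2⌉ + ⌈ n /2⌉
n≤⌈n/2⌉+⌈n/2⌉ zero = z≤n
n≤⌈n/2⌉+⌈n/2⌉ (suc zero) = s≤s z≤n
n≤⌈n/2⌉+⌈n/2⌉ (suc (suc n)) =
  s≤s (subst (suc n ≤_) (sym (+-suc ⌈ n /2⌉ ⌈ n /2⌉)) (s≤s (n≤⌈n/2⌉+⌈n/2⌉ n)))

-- The recursive clause holds definitionally: (4 + n) % 4 reduces to n % 4 and
-- ⌈ 4 + n /2⌉ % 2 to ⌈ n /2⌉ % 2.
⌈n/2⌉%2≡⌈n%4/2⌉%2 : ∀ n → ⌈ n /2⌉ % 2 ≡ ⌈ n % 4 /2⌉ % 2
⌈n/2⌉%2≡⌈n%4/2⌉%2 0 = refl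
⌈n/2⌉%2≡⌈n%4/2⌉%2 1 = refl
⌈n/2⌉%2≡⌈n%4/2⌉%2 2 = refl
⌈n/2⌉%2≡⌈n%4/2⌉%2 3 = refl
⌈n/2⌉%2≡⌈n%4/2⌉%2 (suc (suc (suc (suc n)))) = ⌈n/2⌉%2≡⌈n%4/2⌉%2 n

nimDNG-cycle : ∀ N → NimDNG (Cycle (suc (suc N))) (⌈ suc (suc N) /2⌉ % 2)
nimDNG-cycle N = nimDNG-parity C m nongenerating-small nongenerating-extends
                   (⊆arc⇒¬generating Fin.zero m 2m≤1+n m<n (⊥-elim ∘′ ∉⊥))
  where
  open CycleGeometry (suc N)
  m = ⌈ n /2⌉
  m<n : m < n
  m<n = ⌈n/2⌉<n N
  2m≤1+n : m + m ≤ suc n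
  2m≤1+n = ⌈n/2⌉+⌈n/2⌉≤1+n n
  n≤2m : n ≤ m + m
  n≤2m = n≤⌈n/2⌉+⌈n/2⌉ n

  nongenerating-small : ∀ {P} → ¬ Generating C P → ∣ P ∣ ≤ m
  nongenerating-small ¬generating = let a , P⊆arc = ¬generating⇒⊆arc m n≤2m ¬generating in
    subst (_ ≤_) (∣arc∣ a (<⇒≤ m<n)) (p⊆q⇒∣p∣≤∣q∣ P⊆arc)

  nongenerating-extends : ∀ {P} → ¬ Generating C P → ∣ P ∣ < m → ∃ (Move C P)
  nongenerating-extends {P} ¬generating ∣P∣<m with ¬generating⇒⊆arc m n≤2m ¬generating
  ... | a , P⊆arc with ∣p∣<∣q∣⇒∃∈q∉p (subst (∣ P ∣ <_) (sym (∣arc∣ a (<⇒≤ m<n))) ∣P∣<m)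
  ...   | v , v∈arc , v∉P = v , v∉P , ⊆arc⇒¬generating a m 2m≤1+n m<n P∪⁅v⁆⊆arc
    where
    P∪⁅v⁆⊆arc : P ∪ ⁅ v ⁆ ⊆ arc a m
    P∪⁅v⁆⊆arc x∈P∪⁅v⁆ = [ P⊆arc , (λ x∈⁅v⁆ → subst (_∈ arc a m) (sym (x∈⁅y⁆⇒x≡y v x∈⁅v⁆)) v∈arc) ]′
                           (x∈p∪q⁻ P ⁅ v ⁆ x∈P∪⁅v⁆)

proposition7p3 : (n : ℕ) → 3 ≤ n →
    ((n % 4 ≡ 1 ⊎ n % 4 ≡ 2) → NimDNG (Cycle n) 1)
    × ((n % 4 ≡ 3 ⊎ n % 4 ≡ 0) → NimDNG (Cycle n) 0)
proposition7p3 (suc zero) (s≤s ())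
proposition7p3 n@(suc (suc N)) _ = [ with-residue 1 , with-residue 2 ]′ , [ with-residue 3 , with-residue 0 ]′
  where
  with-residue : ∀ r → n % 4 ≡ r → NimDNG (Cycle n) (⌈ r /2⌉ % 2)
  with-residue _ refl = subst (NimDNG (Cycle n)) (⌈n/2⌉%2≡⌈n%4/2⌉%2 n) (nimDNG-cycle N)
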